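{- Let $h,k$ be positive integers and $q$ a prime power. The number of $(h-1)$-dimensional projective subspaces of $\mathrm{PG}(k-1,q)$ in any collection whose union is a strong blocking set is at least \[\left\lfloor \frac{k-1}{h}\right\rfloor+\left\lceil \frac{k}{h}\right\rceil.\]
   Context: A strong blocking set in $\mathrm{PG}(k-1,q)$ is a set of points $\mathcal{M}$ with $\langle\mathcal{M}\cap H\rangle=H$ for every hyperplane $H$, where $\langle\cdot\rangle$ denotes projective span. -}

module Defs where

open import Level using (0ℓ)
open import Algebra.Bundles using (CommutativeRing)
open import Data.Nat using (ℕ; zero; suc; NonZero)
import Data.Nat as ℕ
open import Data.Nat.DivMod using (_/_)
open import Data.Fin using (Fin)
import Data.Fin
import Data.Product
open import Data.List using (List; []; _∷_)
open import Data.List.Relation.Unary.All using (All)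
open import Data.Product using (Σ; ∃; _×_; _,_)
open import Relation.Nullary using (¬_)
open import Relation.Binary.PropositionalEquality using (_≡_)

⌈_/_⌉ : ℕ → (n : ℕ) → .{{NonZero n}} → ℕ
⌈ m / n ⌉ = (m ℕ.+ n ℕ.∸ 1) / n

record IsFiniteField (R : CommutativeRing 0ℓ 0ℓ) (q : ℕ) : Set where
  open CommutativeRing R
  field
    0≉1     : ¬ (0# ≈ 1#)
    inverse : ∀ x → ¬ (x ≈ 0#) → ∃ λ y → x * y ≈ 1#
    enum    : Fin q → Carrier
    enum-surj : ∀ x → ∃ λ i → enum i ≈ x
    enum-inj  : ∀ i j → enum i ≈ enum j → i ≡ j

module Geometry (R : CommutativeRing 0ℓ 0ℓ) where
  open CommutativeRing R

  Vector : ℕ → Set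
  Vector k = Fin k → Carrier

  _≈v_ : ∀ {k} → Vector k → Vector k → Set
  u ≈v v = ∀ i → u i ≈ v i

  0v : ∀ {k} → Vector k
  0v i = 0#

  _+v_ : ∀ {k} → Vector k → Vector k → Vector k
  (u +v v) i = u i + v i

  _·v_ : ∀ {k} → Carrier → Vector k → Vector k
  (c ·v v) i = c * v i

  sumF : ∀ n → (Fin n → Carrier) → Carrier
  sumF zero f = 0#
  sumF (suc n) f = f Fin.zero + sumF n (λ i → f (Fin.suc i))

  sumV : ∀ {k} n → (Fin n → Vector k) → Vector k
  sumV zero f = 0v
  sumV (suc n) f = f Fin.zero +v sumV n (λ i → f (Fin.suc i))

  comb : ∀ {k h} → (Fin h → Vector k) → (Fin h → Carrier) → Vector k
  comb {h = h} b c = sumV h (λ i → c i ·v b i)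

  lincomb : ∀ {k} → List (Carrier × Vector k) → Vector k
  lincomb [] = 0v
  lincomb ((c , v) ∷ L) = (c ·v v) +v lincomb L

  InSpan : ∀ {k} → (Vector k → Set) → Vector k → Set
  InSpan {k} P x =
    Σ (List (Carrier × Vector k)) λ L →
      All (λ cv → P (Data.Product.proj₂ cv)) L × (lincomb L ≈v x)

  dot : ∀ {k} → Vector k → Vector k → Carrier
  dot {k} a x = sumF k (λ i → a i * x i)

  NonZeroVec : ∀ {k} → Vector k → Set
  NonZeroVec v = ∃ λ i → ¬ (v i ≈ 0#)

  -- the hyperplane of PG(k-1,q) with (nonzero) coordinates a, as the
  -- set of vectors of the corresponding (k-1)-dim subspace of F^k
  Hyperplane : ∀ {k} → Vector k → Vector k → Set
  Hyperplane a x = dot a x ≈ 0#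

  -- A set of points M (given as a scalar-closed set of vectors of F^k,
  -- points of PG(k-1,q) being the 1-dim subspaces) is a strong blocking set
  -- iff for every hyperplane H, ⟨M ∩ H⟩ = H.  (⟨M ∩ H⟩ ⊆ H is automatic.)
  StrongBlocking : ∀ {k} → (Vector k → Set) → Set
  StrongBlocking {k} M =
    (a : Vector k) → NonZeroVec a →
    (x : Vector k) → Hyperplane a x →
    InSpan (λ v → M v × Hyperplane a v) x

  LinIndep : ∀ {k h} → (Fin h → Vector k) → Set
  LinIndep {h = h} b = (c : Fin h → Carrier) → comb b c ≈v 0v → ∀ i → c i ≈ 0#

  UnionOf : ∀ {k h n} → (Fin n → Fin h → Vector k) → Vector k → Set
  UnionOf {h = h} {n = n} B v = ∃ λ (j : Fin n) → ∃ λ (c : Fin h → Carrier) → v ≈v comb (B j) c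

-- Put m = ⌊(k-1)/h⌋, so that m subspaces of dimension at most h span at most mh ≤ k - 1
-- dimensions and therefore lie in a common hyperplane. If n ≤ 2m subspaces formed a strong
-- blocking set, splitting them into two groups of at most m would put their union inside
-- H₁ ∪ H₂. That is impossible: take x outside H₁ ∪ H₂ and the hyperplane H through x in the
-- pencil spanned by H₁ and H₂ (if H₁ = H₂, any hyperplane H through some x ∉ H₁). The
-- blocking points on H lie in H₁ ∩ H, so they cannot span H ∋ x. Hence
-- n ≥ 2m + 1 = ⌊(k-1)/h⌋ + ⌈k/h⌉.
module Submission where

open import Defs
open import Level using (0ℓ)
open import Algebra.Bundles using (CommutativeRing)
import Algebra.Properties.Ring as RingProperties
import Algebra.Properties.Semiring.Sum as SemiringSum
import Algebra.Properties.CommutativeSemigroup as CommutativeSemigroupProperties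
open import Data.Nat as ℕ using (ℕ; zero; suc; s≤s; z≤n)
import Data.Nat.Properties as ℕ
import Data.Nat.DivMod as ℕ
open import Data.Fin using (Fin; zero; suc; _≟_; punchIn; punchOut; join; splitAt; _↑ˡ_; _↑ʳ_; remQuot; combine)
open import Data.Fin.Properties using (all?; ¬∀⟶∃¬; punchIn-punchOut; join-splitAt; remQuot-combine)
import Data.Vec.Functional as Vec
open import Data.List using ([]; _∷_)
open import Data.List.Relation.Unary.All as All using (All; []; _∷_)
open import Data.Product using (∃; _×_; _,_; proj₂; uncurry)
open import Data.Sum using (_⊎_; inj₁; inj₂)
open import Data.Empty using (⊥-elim)
open import Function using (_∘_)
open import Relation.Nullary using (¬_; Dec; yes; no)
open import Relation.Binary.PropositionalEquality as ≡ using (_≡_; subst)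

module HyperplaneProperties (R : CommutativeRing 0ℓ 0ℓ) where
  open CommutativeRing R hiding (zero)
  open Geometry R
  open SemiringSum semiring using (sum; sum-cong-≋; sum-replicate-zero; ∑-distrib-+; *-distribˡ-sum)
  open RingProperties ring using (-‿distribˡ-*)
  open CommutativeSemigroupProperties *-commutativeSemigroup using (x∙yz≈y∙xz)
  open import Relation.Binary.Reasoning.Setoid setoid

  sumF≡sum : ∀ n (f : Fin n → Carrier) → sumF n f ≡ sum f
  sumF≡sum zero    f = ≡.refl
  sumF≡sum (suc n) f = ≡.cong (f zero +_) (sumF≡sum n (Vec.tail f))

  dot≈sum : ∀ {k} (a x : Vector k) → dot a x ≈ sum (λ i → a i * x i)
  dot≈sum {k} a x = reflexive (sumF≡sum k (λ i → a i * x i))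

  dot-congʳ : ∀ {k} (a : Vector k) {u w : Vector k} → u ≈v w → dot a u ≈ dot a w
  dot-congʳ a {u} {w} u≈w = begin
    dot a u                 ≈⟨ dot≈sum a u ⟩
    sum (λ i → a i * u i)   ≈⟨ sum-cong-≋ (λ i → *-congˡ (u≈w i)) ⟩
    sum (λ i → a i * w i)   ≈⟨ dot≈sum a w ⟨
    dot a w                 ∎

  dot-comm : ∀ {k} (a x : Vector k) → dot a x ≈ dot x a
  dot-comm a x = begin
    dot a x                 ≈⟨ dot≈sum a x ⟩
    sum (λ i → a i * x i)   ≈⟨ sum-cong-≋ (λ i → *-comm (a i) (x i)) ⟩
    sum (λ i → x i * a i)   ≈⟨ dot≈sum x a ⟨
    dot x a                 ∎

  dot-0vʳ : ∀ {k} (a : Vector k) → dot a 0v ≈ 0#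
  dot-0vʳ {k} a = begin
    dot a 0v                 ≈⟨ dot≈sum a 0v ⟩
    sum (λ i → a i * 0#)     ≈⟨ sum-cong-≋ (λ i → zeroʳ (a i)) ⟩
    sum (Vec.replicate k 0#) ≈⟨ sum-replicate-zero k ⟩
    0#                       ∎

  dot-zeroˡ : ∀ {k} {a : Vector k} → a ≈v 0v → ∀ x → dot a x ≈ 0#
  dot-zeroˡ {a = a} a≈0 x = begin
    dot a x   ≈⟨ dot-comm a x ⟩
    dot x a   ≈⟨ dot-congʳ x a≈0 ⟩
    dot x 0v  ≈⟨ dot-0vʳ x ⟩
    0#        ∎

  dot-+vʳ : ∀ {k} (a u w : Vector k) → dot a (u +v w) ≈ dot a u + dot a w
  dot-+vʳ a u w = begin
    dot a (u +v w)                                  ≈⟨ dot≈sum a (u +v w) ⟩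
    sum (λ i → a i * (u i + w i))                   ≈⟨ sum-cong-≋ (λ i → distribˡ (a i) (u i) (w i)) ⟩
    sum (λ i → a i * u i + a i * w i)               ≈⟨ ∑-distrib-+ (λ i → a i * u i) (λ i → a i * w i) ⟩
    sum (λ i → a i * u i) + sum (λ i → a i * w i)   ≈⟨ +-cong (dot≈sum a u) (dot≈sum a w) ⟨
    dot a u + dot a w                               ∎

  dot-·vʳ : ∀ {k} (a : Vector k) c (u : Vector k) → dot a (c ·v u) ≈ c * dot a u
  dot-·vʳ a c u = begin
    dot a (c ·v u)                  ≈⟨ dot≈sum a (c ·v u) ⟩
    sum (λ i → a i * (c * u i))     ≈⟨ sum-cong-≋ (λ i → x∙yz≈y∙xz (a i) c (u i)) ⟩
    sum (λ i → c * (a i * u i))     ≈⟨ *-distribˡ-sum c (λ i → a i * u i) ⟨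
    c * sum (λ i → a i * u i)       ≈⟨ *-congˡ (dot≈sum a u) ⟨
    c * dot a u                     ∎

  dot-linearˡ : ∀ {k} α β (a b v : Vector k) →
    dot ((α ·v a) +v (β ·v b)) v ≈ α * dot a v + β * dot b v
  dot-linearˡ α β a b v = begin
    dot ((α ·v a) +v (β ·v b)) v               ≈⟨ dot-comm _ v ⟩
    dot v ((α ·v a) +v (β ·v b))               ≈⟨ dot-+vʳ v _ _ ⟩
    dot v (α ·v a) + dot v (β ·v b)            ≈⟨ +-cong (dot-·vʳ v α a) (dot-·vʳ v β b) ⟩
    α * dot v a + β * dot v b                  ≈⟨ +-cong (*-congˡ (dot-comm v a)) (*-congˡ (dot-comm v b)) ⟩
    α * dot a v + β * dot b v                  ∎

  unit : ∀ {k} → Fin k → Vector k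
  unit zero    zero    = 1#
  unit zero    (suc _) = 0#
  unit (suc _) zero    = 0#
  unit (suc j) (suc i) = unit j i

  unit-diag : ∀ {k} (j : Fin k) → unit j j ≡ 1#
  unit-diag zero    = ≡.refl
  unit-diag (suc j) = unit-diag j

  unit-orthogonal : ∀ {k} → 2 ℕ.≤ k → (i : Fin k) → ∃ λ j → unit j i ≡ 0#
  unit-orthogonal (s≤s (s≤s z≤n)) zero    = suc zero , ≡.refl
  unit-orthogonal (s≤s (s≤s z≤n)) (suc i) = zero , ≡.refl

  dot-unitʳ : ∀ {k} (a : Vector k) j → dot a (unit j) ≈ a j
  dot-unitʳ a zero    = trans (+-cong (*-identityʳ (a zero)) (dot-0vʳ (Vec.tail a))) (+-identityʳ (a zero))
  dot-unitʳ a (suc j) = trans (+-cong (zeroʳ (a zero)) (dot-unitʳ (Vec.tail a) j)) (+-identityˡ (a (suc j)))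

  dot-unitˡ : ∀ {k} j (x : Vector k) → dot (unit j) x ≈ x j
  dot-unitˡ j x = trans (dot-comm (unit j) x) (dot-unitʳ x j)

  hyperplane-+v : ∀ {k} (a u w : Vector k) → Hyperplane a u → Hyperplane a w → Hyperplane a (u +v w)
  hyperplane-+v a u w au≈0 aw≈0 =
    trans (dot-+vʳ a u w) (trans (+-cong au≈0 aw≈0) (+-identityˡ 0#))

  hyperplane-·v : ∀ {k} (a : Vector k) c u → Hyperplane a u → Hyperplane a (c ·v u)
  hyperplane-·v a c u au≈0 = trans (dot-·vʳ a c u) (trans (*-congˡ au≈0) (zeroʳ c))

  hyperplane-lincomb : ∀ {k} (a : Vector k) L → All (Hyperplane a ∘ proj₂) L → Hyperplane a (lincomb L)
  hyperplane-lincomb a []            []        = dot-0vʳ a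
  hyperplane-lincomb a ((c , v) ∷ L) (av ∷ aL) =
    hyperplane-+v a (c ·v v) (lincomb L) (hyperplane-·v a c v av) (hyperplane-lincomb a L aL)

  hyperplane-sumV : ∀ {k} (a : Vector k) n (f : Fin n → Vector k) → (∀ i → Hyperplane a (f i)) →
    Hyperplane a (sumV n f)
  hyperplane-sumV a zero    f af = dot-0vʳ a
  hyperplane-sumV a (suc n) f af =
    hyperplane-+v a (f zero) (sumV n (Vec.tail f)) (af zero) (hyperplane-sumV a n (Vec.tail f) (af ∘ suc))

  hyperplane-comb : ∀ {k h} (a : Vector k) (b : Fin h → Vector k) →
    (∀ i → Hyperplane a (b i)) → ∀ c → Hyperplane a (comb b c)
  hyperplane-comb {h = h} a b ab c =
    hyperplane-sumV a h (λ i → c i ·v b i) (λ i → hyperplane-·v a (c i) (b i) (ab i))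

  pencilThrough : ∀ {k} (a₁ a₂ x : Vector k) → Vector k
  pencilThrough a₁ a₂ x = (dot a₂ x ·v a₁) +v ((- dot a₁ x) ·v a₂)

  pencilThrough-∋ : ∀ {k} (a₁ a₂ x : Vector k) → Hyperplane (pencilThrough a₁ a₂ x) x
  pencilThrough-∋ a₁ a₂ x = begin
    dot (pencilThrough a₁ a₂ x) x                   ≈⟨ dot-linearˡ (dot a₂ x) (- dot a₁ x) a₁ a₂ x ⟩
    dot a₂ x * dot a₁ x + - dot a₁ x * dot a₂ x     ≈⟨ +-congˡ (-‿distribˡ-* (dot a₁ x) (dot a₂ x)) ⟨
    dot a₂ x * dot a₁ x + - (dot a₁ x * dot a₂ x)   ≈⟨ +-congˡ (-‿cong (*-comm (dot a₁ x) (dot a₂ x))) ⟩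
    dot a₂ x * dot a₁ x + - (dot a₂ x * dot a₁ x)   ≈⟨ -‿inverseʳ (dot a₂ x * dot a₁ x) ⟩
    0#                                              ∎

  strongBlocking-⊆ : ∀ {k} {M : Vector k → Set} → StrongBlocking M →
    ∀ {a f} → NonZeroVec a → (∀ v → M v → Hyperplane a v → Hyperplane f v) →
    ∀ x → Hyperplane a x → Hyperplane f x
  strongBlocking-⊆ SB {a} {f} a≉0 M∩H⊆H′ x ax with SB a a≉0 x ax
  ... | L , L⊆M∩H , L≈x =
    trans (sym (dot-congʳ f L≈x)) (hyperplane-lincomb f L (All.map (uncurry (M∩H⊆H′ _)) L⊆M∩H))

record IsDecidableField (R : CommutativeRing 0ℓ 0ℓ) : Set where
  open CommutativeRing R
  field
    0≉1     : ¬ (0# ≈ 1#)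
    inverse : ∀ x → ¬ (x ≈ 0#) → ∃ λ y → x * y ≈ 1#
    _≈0?    : ∀ x → Dec (x ≈ 0#)

isFiniteField⇒isDecidableField : ∀ {R q} → IsFiniteField R q → IsDecidableField R
isFiniteField⇒isDecidableField {R} F = record
  { 0≉1 = 0≉1 ; inverse = inverse ; _≈0? = λ x → ≈-dec x 0# }
  where
  open CommutativeRing R
  open IsFiniteField F
  ≈-dec : ∀ x y → Dec (x ≈ y)
  ≈-dec x y with enum-surj x | enum-surj y
  ... | i , eᵢ≈x | j , eⱼ≈y with i ≟ j
  ...   | yes ≡.refl = yes (trans (sym eᵢ≈x) eⱼ≈y)
  ...   | no i≢j     = no (λ x≈y → i≢j (enum-inj i j (trans eᵢ≈x (trans x≈y (sym eⱼ≈y)))))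

module FieldGeometry {R : CommutativeRing 0ℓ 0ℓ} (F : IsDecidableField R) where
  open CommutativeRing R hiding (zero)
  open IsDecidableField F
  open Geometry R
  open HyperplaneProperties R
  open RingProperties ring using (-‿distribˡ-*)
  open CommutativeSemigroupProperties *-commutativeSemigroup using (xy∙z≈zx∙y)
  open import Relation.Binary.Reasoning.Setoid setoid

  1≉0 : ¬ (1# ≈ 0#)
  1≉0 = 0≉1 ∘ sym

  x≉0∧x*y≈0⇒y≈0 : ∀ {x y} → ¬ (x ≈ 0#) → x * y ≈ 0# → y ≈ 0#
  x≉0∧x*y≈0⇒y≈0 {x} {y} x≉0 xy≈0 with inverse x x≉0
  ... | x⁻¹ , xx⁻¹≈1 = begin
    y               ≈⟨ *-identityˡ y ⟨
    1# * y          ≈⟨ *-congʳ (trans (sym xx⁻¹≈1) (*-comm x x⁻¹)) ⟩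
    (x⁻¹ * x) * y   ≈⟨ *-assoc x⁻¹ x y ⟩
    x⁻¹ * (x * y)   ≈⟨ *-congˡ xy≈0 ⟩
    x⁻¹ * 0#        ≈⟨ zeroʳ x⁻¹ ⟩
    0#              ∎

  unit-nonzero : ∀ {k} (j : Fin k) → NonZeroVec (unit j)
  unit-nonzero j = j , 1≉0 ∘ trans (reflexive (≡.sym (unit-diag j)))

  CommonHyperplane : ∀ {k} {I : Set} → (I → Vector k) → Set
  CommonHyperplane u = ∃ λ a → NonZeroVec a × (∀ l → Hyperplane a (u l))

  -- Gaussian elimination step: with pivot p = u l₀ 0, the reduced family consists of the
  -- vectors u l - (u l 0 / p) u l₀, l ≠ l₀, with their vanishing first coordinate dropped.
  eliminate : ∀ {k r} (u : Fin (suc r) → Vector (suc k)) → Fin (suc r) → Carrier → Fin r → Vector k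
  eliminate u l₀ p⁻¹ l = Vec.tail (u (punchIn l₀ l)) +v ((- (u (punchIn l₀ l) zero * p⁻¹)) ·v Vec.tail (u l₀))

  liftCommonHyperplane : ∀ {k r} (u : Fin (suc r) → Vector (suc k)) l₀ {p⁻¹} → u l₀ zero * p⁻¹ ≈ 1# →
    CommonHyperplane (eliminate u l₀ p⁻¹) → CommonHyperplane u
  liftCommonHyperplane u l₀ {p⁻¹} pp⁻¹≈1 (b , (i , bᵢ≉0) , b⊥) = a , (suc i , bᵢ≉0) , a⊥
    where
    d = dot b (Vec.tail (u l₀))
    a = (- (p⁻¹ * d)) Vec.∷ b
    a⊥pivot : Hyperplane a (u l₀)
    a⊥pivot = begin
      - (p⁻¹ * d) * p + d     ≈⟨ +-congʳ (-‿distribˡ-* (p⁻¹ * d) p) ⟨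
      - (p⁻¹ * d * p) + d     ≈⟨ +-congʳ (-‿cong p⁻¹dp≈d) ⟩
      - d + d                 ≈⟨ -‿inverseˡ d ⟩
      0#                      ∎
      where
      p = u l₀ zero
      p⁻¹dp≈d : p⁻¹ * d * p ≈ d
      p⁻¹dp≈d = trans (xy∙z≈zx∙y p⁻¹ d p) (trans (*-congʳ pp⁻¹≈1) (*-identityˡ d))
    a⊥other : ∀ l → Hyperplane a (u (punchIn l₀ l))
    a⊥other l = begin
      - (p⁻¹ * d) * c + dot b w                ≈⟨ +-congʳ -[p⁻¹d]c≈sd ⟩
      s * d + dot b w                          ≈⟨ +-comm (s * d) (dot b w) ⟩
      dot b w + s * d                          ≈⟨ +-congˡ (dot-·vʳ b s (Vec.tail (u l₀))) ⟨
      dot b w + dot b (s ·v Vec.tail (u l₀))   ≈⟨ dot-+vʳ b w (s ·v Vec.tail (u l₀)) ⟨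
      dot b (eliminate u l₀ p⁻¹ l)             ≈⟨ b⊥ l ⟩
      0#                                       ∎
      where
      c = u (punchIn l₀ l) zero
      w = Vec.tail (u (punchIn l₀ l))
      s = - (c * p⁻¹)
      -[p⁻¹d]c≈sd : - (p⁻¹ * d) * c ≈ s * d
      -[p⁻¹d]c≈sd = begin
        - (p⁻¹ * d) * c    ≈⟨ -‿distribˡ-* (p⁻¹ * d) c ⟨
        - (p⁻¹ * d * c)    ≈⟨ -‿cong (xy∙z≈zx∙y p⁻¹ d c) ⟩
        - (c * p⁻¹ * d)    ≈⟨ -‿distribˡ-* (c * p⁻¹) d ⟩
        s * d              ∎
    a⊥ : ∀ l → Hyperplane a (u l)
    a⊥ l with l₀ ≟ l
    ... | yes ≡.refl = a⊥pivot
    ... | no l₀≢l    = subst (Hyperplane a ∘ u) (punchIn-punchOut l₀≢l) (a⊥other (punchOut l₀≢l))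

  commonHyperplane : ∀ {k r} → r ℕ.< k → (u : Fin r → Vector k) → CommonHyperplane u
  commonHyperplane {suc k} {zero}  _         u = unit zero , unit-nonzero zero , λ ()
  commonHyperplane {suc k} {suc r} (s≤s r<k) u with all? (λ l → u l zero ≈0?)
  ... | yes u·0≈0 = unit zero , unit-nonzero zero , λ l → trans (dot-unitˡ zero (u l)) (u·0≈0 l)
  ... | no u·0≉0 with ¬∀⟶∃¬ _ _ (λ l → u l zero ≈0?) u·0≉0
  ...   | l₀ , p≉0 with inverse (u l₀ zero) p≉0
  ...     | p⁻¹ , pp⁻¹≈1 = liftCommonHyperplane u l₀ pp⁻¹≈1 (commonHyperplane r<k (eliminate u l₀ p⁻¹))

  commonHyperplane-subspaces : ∀ {k m h} → m ℕ.* h ℕ.< k → (B : Fin m → Fin h → Vector k) →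
    CommonHyperplane (uncurry B)
  commonHyperplane-subspaces {h = h} mh<k B with commonHyperplane mh<k (uncurry B ∘ remQuot h)
  ... | a , a≉0 , a⊥ =
    a , a≉0 , λ (j , i) → subst (Hyperplane a ∘ uncurry B) (remQuot-combine j i) (a⊥ (combine j i))

  avoid-two-hyperplanes : ∀ {k} {a b : Vector k} → NonZeroVec a → NonZeroVec b →
    ∃ λ x → ¬ Hyperplane a x × ¬ Hyperplane b x
  avoid-two-hyperplanes {a = a} {b} (i , aᵢ≉0) (j , bⱼ≉0) with b i ≈0? | a j ≈0?
  ... | no bᵢ≉0  | _        =
    unit i , aᵢ≉0 ∘ trans (sym (dot-unitʳ a i)) , bᵢ≉0 ∘ trans (sym (dot-unitʳ b i))
  ... | yes _     | no aⱼ≉0  =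
    unit j , aⱼ≉0 ∘ trans (sym (dot-unitʳ a j)) , bⱼ≉0 ∘ trans (sym (dot-unitʳ b j))
  ... | yes bᵢ≈0 | yes aⱼ≈0 =
    unit i +v unit j , aᵢ≉0 ∘ trans (sym aeᵢ+aeⱼ≈aᵢ) , bⱼ≉0 ∘ trans (sym beᵢ+beⱼ≈bⱼ)
    where
    aeᵢ+aeⱼ≈aᵢ : dot a (unit i +v unit j) ≈ a i
    aeᵢ+aeⱼ≈aᵢ = trans (dot-+vʳ a _ _)
      (trans (+-cong (dot-unitʳ a i) (trans (dot-unitʳ a j) aⱼ≈0)) (+-identityʳ (a i)))
    beᵢ+beⱼ≈bⱼ : dot b (unit i +v unit j) ≈ b j
    beᵢ+beⱼ≈bⱼ = trans (dot-+vʳ b _ _)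
      (trans (+-cong (trans (dot-unitʳ b i) bᵢ≈0) (dot-unitʳ b j)) (+-identityˡ (b j)))

  strongBlocking⊈hyperplane : ∀ {k} {M : Vector k → Set} → 2 ℕ.≤ k → StrongBlocking M →
    ∀ {a} → NonZeroVec a → ¬ (∀ v → M v → Hyperplane a v)
  strongBlocking⊈hyperplane 2≤k SB {a} (i , aᵢ≉0) M⊆H with unit-orthogonal 2≤k i
  ... | j , eⱼᵢ≡0 =
    aᵢ≉0 (trans (sym (dot-unitʳ a i))
      (strongBlocking-⊆ SB (unit-nonzero j) (λ v Mv _ → M⊆H v Mv) (unit i)
        (trans (dot-unitʳ (unit j) i) (reflexive eⱼᵢ≡0))))

  pencilThrough-⊆ : ∀ {k} (a₁ a₂ x v : Vector k) → ¬ Hyperplane a₂ x →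
    Hyperplane a₁ v ⊎ Hyperplane a₂ v → Hyperplane (pencilThrough a₁ a₂ x) v → Hyperplane a₁ v
  pencilThrough-⊆ a₁ a₂ x v x∉H₂ (inj₁ v∈H₁) v∈H = v∈H₁
  pencilThrough-⊆ a₁ a₂ x v x∉H₂ (inj₂ v∈H₂) v∈H = x≉0∧x*y≈0⇒y≈0 x∉H₂ (begin
    dot a₂ x * dot a₁ v                            ≈⟨ +-identityʳ (dot a₂ x * dot a₁ v) ⟨
    dot a₂ x * dot a₁ v + 0#                       ≈⟨ +-congˡ (trans (*-congˡ v∈H₂) (zeroʳ _)) ⟨
    dot a₂ x * dot a₁ v + - dot a₁ x * dot a₂ v    ≈⟨ dot-linearˡ (dot a₂ x) (- dot a₁ x) a₁ a₂ v ⟨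
    dot (pencilThrough a₁ a₂ x) v                  ≈⟨ v∈H ⟩
    0#                                             ∎)

  strongBlocking⊈hyperplane∪hyperplane : ∀ {k} {M : Vector k → Set} → 2 ℕ.≤ k → StrongBlocking M →
    ∀ {a₁ a₂} → NonZeroVec a₁ → NonZeroVec a₂ → ¬ (∀ v → M v → Hyperplane a₁ v ⊎ Hyperplane a₂ v)
  strongBlocking⊈hyperplane∪hyperplane {M = M} 2≤k SB {a₁} {a₂} a₁≉0 a₂≉0 M⊆H₁∪H₂
    with avoid-two-hyperplanes a₁≉0 a₂≉0
  ... | x , x∉H₁ , x∉H₂ = impossible (all? (λ i → a i ≈0?))
    where
    a = pencilThrough a₁ a₂ x
    M∩H⊆H₁ : ∀ v → M v → Hyperplane a v → Hyperplane a₁ v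
    M∩H⊆H₁ v Mv = pencilThrough-⊆ a₁ a₂ x v x∉H₂ (M⊆H₁∪H₂ v Mv)
    impossible : ¬ Dec (a ≈v 0v)
    impossible (yes a≈0) = strongBlocking⊈hyperplane 2≤k SB a₁≉0 (λ v Mv → M∩H⊆H₁ v Mv (dot-zeroˡ a≈0 v))
    impossible (no a≉0)  =
      x∉H₁ (strongBlocking-⊆ SB (¬∀⟶∃¬ _ _ (λ i → a i ≈0?) a≉0) M∩H⊆H₁ x (pencilThrough-∋ a₁ a₂ x))

  ¬strongBlocking-twoGroups : ∀ {k h m₁ m₂} → 2 ℕ.≤ k → m₁ ℕ.* h ℕ.< k → m₂ ℕ.* h ℕ.< k →
    (B : Fin (m₁ ℕ.+ m₂) → Fin h → Vector k) → ¬ StrongBlocking (UnionOf B)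
  ¬strongBlocking-twoGroups {m₁ = m₁} {m₂} 2≤k m₁h<k m₂h<k B SB
    with commonHyperplane-subspaces m₁h<k (B ∘ (_↑ˡ m₂)) | commonHyperplane-subspaces m₂h<k (B ∘ (m₁ ↑ʳ_))
  ... | a₁ , a₁≉0 , B₁⊆H₁ | a₂ , a₂≉0 , B₂⊆H₂ =
    strongBlocking⊈hyperplane∪hyperplane 2≤k SB a₁≉0 a₂≉0 union⊆H₁∪H₂
    where
    group⊆H : ∀ s → (∀ i → Hyperplane a₁ (B (join m₁ m₂ s) i)) ⊎ (∀ i → Hyperplane a₂ (B (join m₁ m₂ s) i))
    group⊆H (inj₁ j) = inj₁ (λ i → B₁⊆H₁ (j , i))
    group⊆H (inj₂ j) = inj₂ (λ i → B₂⊆H₂ (j , i))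
    union⊆H₁∪H₂ : ∀ v → UnionOf B v → Hyperplane a₁ v ⊎ Hyperplane a₂ v
    union⊆H₁∪H₂ v (j , c , v≈Bc)
      with subst (λ j → (∀ i → Hyperplane a₁ (B j i)) ⊎ (∀ i → Hyperplane a₂ (B j i)))
                 (join-splitAt m₁ m₂ j) (group⊆H (splitAt m₁ j))
    ... | inj₁ Bj⊆H₁ = inj₁ (trans (dot-congʳ a₁ v≈Bc) (hyperplane-comb a₁ (B j) Bj⊆H₁ c))
    ... | inj₂ Bj⊆H₂ = inj₂ (trans (dot-congʳ a₂ v≈Bc) (hyperplane-comb a₂ (B j) Bj⊆H₂ c))

  strongBlocking-union-size : ∀ {k h n} m → 2 ℕ.≤ k → m ℕ.* h ℕ.< k → (B : Fin n → Fin h → Vector k) →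
    StrongBlocking (UnionOf B) → m ℕ.+ m ℕ.< n
  strongBlocking-union-size {k} {h} {n} m 2≤k mh<k B SB with m ℕ.+ m ℕ.<? n
  ... | yes 2m<n = 2m<n
  ... | no 2m≮n = ⊥-elim (subst (λ n → (B : Fin n → Fin h → Vector k) → ¬ StrongBlocking (UnionOf B))
                                  (ℕ.m⊓n+n∸m≡n m n)
                                  (¬strongBlocking-twoGroups {m₁ = m ℕ.⊓ n} {n ℕ.∸ m} 2≤k m₁h<k m₂h<k) B SB)
    where
    m₁h<k : (m ℕ.⊓ n) ℕ.* h ℕ.< k
    m₁h<k = ℕ.≤-<-trans (ℕ.*-monoˡ-≤ h (ℕ.m⊓n≤m m n)) mh<k
    m₂h<k : (n ℕ.∸ m) ℕ.* h ℕ.< k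
    m₂h<k = ℕ.≤-<-trans (ℕ.*-monoˡ-≤ h (ℕ.m≤n+o⇒m∸n≤o n m (ℕ.≮⇒≥ 2m≮n))) mh<k

open import Data.Nat using (_≤_; _+_; _∸_; NonZero)
open import Data.Nat.DivMod using (_/_)

⌈suc-n/h⌉≡suc⌊n/h⌋ : ∀ n h .{{_ : NonZero h}} → ⌈ suc n / h ⌉ ≡ suc (n / h)
⌈suc-n/h⌉≡suc⌊n/h⌋ n h = ≡.trans (ℕ.m/n≡1+[m∸n]/n (ℕ.m≤n+m h n)) (≡.cong (λ m → suc (m / h)) (ℕ.m+n∸n≡m n h))

⌊n/h⌋*h<suc-n : ∀ n h .{{_ : NonZero h}} → (n / h) ℕ.* h ℕ.< suc n
⌊n/h⌋*h<suc-n n h = s≤s (ℕ.m/n*n≤m n h)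

mainTheorem13 : (R : CommutativeRing 0ℓ 0ℓ) (q : ℕ) → IsFiniteField R q →
    let open Geometry R in
    (h k : ℕ) .{{_ : NonZero h}} → 2 ≤ k →
    (n : ℕ) (B : Fin n → Fin h → Vector k) →
    (∀ j → LinIndep (B j)) →
    StrongBlocking (UnionOf B) →
    (k ∸ 1) / h + ⌈ k / h ⌉ ≤ n
mainTheorem13 R _ F h (suc k) 2≤k n B _ SB = begin
  k / h + ⌈ suc k / h ⌉    ≡⟨ ≡.cong (k / h +_) (⌈suc-n/h⌉≡suc⌊n/h⌋ k h) ⟩
  k / h + suc (k / h)      ≡⟨ ℕ.+-suc (k / h) (k / h) ⟩
  suc (k / h + k / h)      ≤⟨ strongBlocking-union-size (k / h) 2≤k (⌊n/h⌋*h<suc-n k h) B SB ⟩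
  n                        ∎
  where
  open ℕ.≤-Reasoning
  open FieldGeometry (isFiniteField⇒isDecidableField F)
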